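{- Let $\mathcal{M}=(E,\mathcal{I})$ be a matroid on a finite set $E$, let $X\subseteq\{0,1\}^E$ be the set of incidence vectors of bases of $\mathcal{M}$, and let $\mathcal{C}$ be the class of non-decreasing cost functions $c\colon X\to\mathbb{R}$. Then for $S\subseteq E$ the following are equivalent: (i) $S$ is controlling for $(X,\mathcal{C})$; (ii) $S$ is identifying for $X$; (iii) $|S\cap C|\ge |C|-1$ for every circuit $C$ of $\mathcal{M}$.
   Context: A set $S \subseteq E$ is controlling for $(X,\mathcal{C})$ if for every $c \in \mathcal{C}$ and every $x^* \in X$ there is $\gamma \in \mathbb{R}^S$ such that $\min_{x \in X}\{c(x) + \sum_{e\in S}\gamma_e x_e\}$ exists and is attained at $x^*$. A set $S$ is identifying for $X$ if for all $x\ne x'$ in $X$ there is $e\in S$ with $x_e\ne x'_e$. A circuit is an inclusion-wise minimal dependent set of $\mathcal{M}$. Non-decreasing means $c(x)\le c(y)$ whenever $x\le y$ componentwise. -}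

module Defs where

open import Level using (0ℓ)
open import Data.Nat using (ℕ; zero; suc; _∸_)
import Data.Nat as ℕ
open import Data.Bool using (Bool; true; false; if_then_else_)
open import Data.Fin using (Fin; zero; suc)
open import Data.Fin.Subset using (Subset; _∈_; _∉_; _⊆_; _∩_; _∪_; ⁅_⁆; ∣_∣)
  renaming (⊥ to ∅)
open import Data.Vec using (Vec; []; _∷_; lookup)
open import Data.Product using (Σ; ∃; _×_; _,_; proj₁)
open import Relation.Nullary using (¬_)
open import Relation.Unary using (Decidable)
open import Relation.Binary using (Rel; IsTotalOrder)
open import Relation.Binary.PropositionalEquality using (_≡_; _≢_)
open import Algebra.Core using (Op₁; Op₂)
open import Algebra.Structures using (IsCommutativeRing)

-- Matroids on the ground set E = Fin n (independence axioms).
-- Subsets of E are 'Subset n' = Vec Bool n, which is literally the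
-- incidence vector in {0,1}^E (true = 1, false = 0).

record Matroid (n : ℕ) : Set₁ where
  field
    Indep      : Subset n → Set
    indep?     : Decidable Indep
    indep-∅    : Indep ∅
    indep-⊆    : ∀ A B → B ⊆ A → Indep A → Indep B
    indep-aug  : ∀ A B → Indep A → Indep B → ∣ A ∣ ℕ.< ∣ B ∣ →
                 ∃ λ e → e ∈ B × e ∉ A × Indep (A ∪ ⁅ e ⁆)

module _ {n : ℕ} (M : Matroid n) where
  open Matroid M

  IsBasis : Subset n → Set
  IsBasis B = Indep B × (∀ A → Indep A → B ⊆ A → A ≡ B)

  IsCircuit : Subset n → Set
  IsCircuit C = ¬ Indep C × (∀ D → D ⊆ C → D ≢ C → Indep D)

  Bases : Set
  Bases = Σ (Subset n) IsBasis

record Reals : Set₁ where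
  infixl 6 _+_
  infixl 7 _*_
  infix 4 _≈_ _≤_
  field
    Carrier   : Set
    _≈_       : Rel Carrier 0ℓ
    _+_ _*_   : Op₂ Carrier
    -_        : Op₁ Carrier
    0# 1#     : Carrier
    isCommutativeRing : IsCommutativeRing _≈_ _+_ _*_ -_ 0# 1#
    0≉1       : ¬ (0# ≈ 1#)
    inverse   : ∀ x → ¬ (x ≈ 0#) → ∃ λ y → x * y ≈ 1#
    _≤_       : Rel Carrier 0ℓ
    isTotalOrder : IsTotalOrder _≈_ _≤_
    +-mono-≤  : ∀ {x y} z → x ≤ y → x + z ≤ y + z
    *-nonneg  : ∀ {x y} → 0# ≤ x → 0# ≤ y → 0# ≤ x * y
    complete  : (P : Carrier → Set) → ∃ P → (∃ λ b → ∀ x → P x → x ≤ b) →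
                ∃ λ s → (∀ x → P x → x ≤ s) ×
                        (∀ b → (∀ x → P x → x ≤ b) → s ≤ b)

module _ (R : Reals) where
  open Reals R

  -- Σ_{e ∈ A} γ_e ; applied with A = S ∩ x this is Σ_{e∈S} γ_e x_e
  weight : ∀ {n} → (Fin n → Carrier) → Subset n → Carrier
  weight {zero}  γ []      = 0#
  weight {suc n} γ (b ∷ A) = (if b then γ zero else 0#) + weight (λ i → γ (suc i)) A

  module _ {n : ℕ} (M : Matroid n) where

    NonDecreasing : (Bases M → Carrier) → Set
    NonDecreasing c = ∀ x y → proj₁ x ⊆ proj₁ y → c x ≤ c y

    Controlling : Subset n → Set
    Controlling S =
      ∀ (c : Bases M → Carrier) → NonDecreasing c → ∀ (x* : Bases M) →
      ∃ λ (γ : Fin n → Carrier) →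
        ∀ (x : Bases M) →
          c x* + weight γ (S ∩ proj₁ x*) ≤ c x + weight γ (S ∩ proj₁ x)

Identifying : ∀ {n} → Matroid n → Subset n → Set
Identifying {n} M S = ∀ (x x' : Bases M) → proj₁ x ≢ proj₁ x' →
  ∃ λ (e : Fin n) → e ∈ S × lookup (proj₁ x) e ≢ lookup (proj₁ x') e

CircuitCondition : ∀ {n} → Matroid n → Subset n → Set
CircuitCondition {n} M S = ∀ (C : Subset n) → IsCircuit M C → ∣ C ∣ ∸ 1 ℕ.≤ ∣ S ∩ C ∣

{-# OPTIONS --safe #-}
module Submission where

-- Bases form an antichain, so the cost that is 1 at a basis x and 0 elsewhere is non-decreasing;
-- if bases x ≠ x' agree on S, no γ makes x optimal against x', so controlling sets are identifying.
-- Conversely, for a cost c and a basis x* put γ = -K on x* and +K off x*: a basis differing from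
-- x* somewhere on S pays at least K more on S, and K = c x* - min c makes x* optimal.
-- The circuit condition says that at most one element of each circuit lies outside S. Then if
-- bases x ≠ x' agreed on S, the fundamental circuit C ⊆ x + e of some e ∈ x' \ x would have
-- e ∉ S, so C - e ⊆ S ∩ x ⊆ x' and C ⊆ x'. If instead a circuit C had two elements e ≠ f outside
-- S, extending C - e to a basis B and exchanging f for e gives two bases differing only at e, f.

open import Defs
open import Algebra.Bundles using (CommutativeRing)
import Algebra.Properties.CommutativeSemigroup as CommutativeSemigroupProperties
import Algebra.Properties.Group as GroupProperties
import Algebra.Properties.Ring as RingProperties
open import Data.Bool using (true; false; _∧_; if_then_else_)
import Data.Bool as Bool
open import Data.Bool.Properties using (⇔→≡)
open import Data.Empty using (⊥-elim)
open import Data.Fin using (Fin; zero; suc; _≟_)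
open import Data.Fin.Properties using (any?)
open import Data.Fin.Subset
  using (Subset; _∈_; _∉_; _⊆_; _⊂_; _⊃_; _∩_; _∪_; _-_; ⁅_⁆; ∣_∣; ⊤)
open import Data.Fin.Subset.Induction using (⊂-wellFounded; ⊃-wellFounded)
open import Data.Fin.Subset.Properties
open import Data.Nat using (ℕ)
import Data.Nat as ℕ
open import Data.Product using (∃; ∃₂; _×_; _,_; proj₁; proj₂)
open import Data.Sum using (_⊎_; inj₁; inj₂)
import Data.Sum as Sum
open import Data.Vec using ([]; _∷_; here; there; lookup)
open import Data.Vec.Properties using (≡-dec; []=⇒lookup; lookup⇒[]=; lookup-zipWith)
open import Function.Base using (_∘_)
open import Function.Bundles using (_⇔_; mk⇔; Equivalence)
open import Induction.WellFounded using (Acc; acc)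
open import Level using (0ℓ)
open import Relation.Binary using (IsTotalOrder)
open import Relation.Binary.Bundles using (Poset)
open import Relation.Binary.Definitions using (DecidableEquality)
open import Relation.Binary.PropositionalEquality
  using (_≡_; _≢_; refl; sym; trans; cong; cong₂; subst)
open import Relation.Nullary using (¬_; yes; no; ¬?; does; contradiction)
open import Relation.Nullary.Decidable using (_×-dec_; decidable-stable; map′; dec-true; dec-false)
open import Relation.Unary using (Decidable)

module SubsetProperties where
  open import Data.Nat using (suc; _≤_; _∸_; s≤s)
  open import Data.Nat.Properties
    using (≤-refl; ≤-trans; n≤1+n; <-irrefl; m∸n≤m; ∸-monoˡ-≤; module ≤-Reasoning)

  private variable
    n : ℕ
    p q r : Subset n
    x y : Fin n

  _≟ₛ_ : DecidableEquality (Subset n)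
  _≟ₛ_ = ≡-dec Bool._≟_

  p⊈q⇒∃x∈p∉q : ¬ p ⊆ q → ∃ λ x → x ∈ p × x ∉ q
  p⊈q⇒∃x∈p∉q {p = p} {q = q} p⊈q with any? (λ x → (x ∈? p) ×-dec ¬? (x ∈? q))
  ... | yes witness = witness
  ... | no none = contradiction
    (λ {x} x∈p → decidable-stable (x ∈? q) (λ x∉q → none (x , x∈p , x∉q))) p⊈q

  x∈p∪⁅x⁆ : x ∈ p ∪ ⁅ x ⁆
  x∈p∪⁅x⁆ {x = x} = x∈p∪q⁺ (inj₂ (x∈⁅x⁆ x))

  x∈p∪⁅y⁆⁻ : x ∈ p ∪ ⁅ y ⁆ → x ∈ p ⊎ x ≡ y
  x∈p∪⁅y⁆⁻ {p = p} {y = y} = Sum.map₂ (x∈⁅y⁆⇒x≡y y) ∘ x∈p∪q⁻ p ⁅ y ⁆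

  x∉p⇒p⊂p∪⁅x⁆ : x ∉ p → p ⊂ p ∪ ⁅ x ⁆
  x∉p⇒p⊂p∪⁅x⁆ {x = x} x∉p = p⊆p∪q ⁅ x ⁆ , x , x∈p∪⁅x⁆ , x∉p

  p⊆r∧x∈r⇒p∪⁅x⁆⊆r : p ⊆ r → x ∈ r → p ∪ ⁅ x ⁆ ⊆ r
  p⊆r∧x∈r⇒p∪⁅x⁆⊆r p⊆r x∈r y∈p∪⁅x⁆ with x∈p∪⁅y⁆⁻ y∈p∪⁅x⁆
  ... | inj₁ y∈p  = p⊆r y∈p
  ... | inj₂ refl = x∈r

  p-x⊆r∧x∈r⇒p⊆r : p - x ⊆ r → x ∈ r → p ⊆ r
  p-x⊆r∧x∈r⇒p⊆r {x = x} p-x⊆r x∈r {y} y∈p with y ≟ x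
  ... | yes refl = x∈r
  ... | no y≢x   = p-x⊆r (x∈p∧x≢y⇒x∈p-y y∈p y≢x)

  x∉p-x : ∀ (p : Subset n) x → x ∉ p - x
  x∉p-x (_ ∷ p) zero    ()
  x∉p-x (_ ∷ p) (suc x) (there x∈p-x) = x∉p-x p x x∈p-x

  x∈p-y⇒x≢y : x ∈ p - y → x ≢ y
  x∈p-y⇒x≢y {p = p} x∈p-y refl = x∉p-x p _ x∈p-y

  ∣p∪⁅x⁆∣≤1+∣p∣ : ∀ (p : Subset n) x → ∣ p ∪ ⁅ x ⁆ ∣ ≤ suc ∣ p ∣
  ∣p∪⁅x⁆∣≤1+∣p∣ (true  ∷ p) zero    rewrite ∪-identityʳ p = n≤1+n _
  ∣p∪⁅x⁆∣≤1+∣p∣ (false ∷ p) zero    rewrite ∪-identityʳ p = ≤-refl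
  ∣p∪⁅x⁆∣≤1+∣p∣ (true  ∷ p) (suc x) = s≤s (∣p∪⁅x⁆∣≤1+∣p∣ p x)
  ∣p∪⁅x⁆∣≤1+∣p∣ (false ∷ p) (suc x) = ∣p∪⁅x⁆∣≤1+∣p∣ p x

  ∣p∣≤1+∣p-x∣ : ∀ (p : Subset n) x → ∣ p ∣ ≤ suc ∣ p - x ∣
  ∣p∣≤1+∣p-x∣ p x = ≤-trans (p⊆q⇒∣p∣≤∣q∣ p⊆p-x∪⁅x⁆) (∣p∪⁅x⁆∣≤1+∣p∣ (p - x) x)
    where
    p⊆p-x∪⁅x⁆ : p ⊆ (p - x) ∪ ⁅ x ⁆
    p⊆p-x∪⁅x⁆ = p-x⊆r∧x∈r⇒p⊆r (p⊆p∪q ⁅ x ⁆) x∈p∪⁅x⁆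

  lookup≡∧∈⇒∈ : lookup p x ≡ lookup q x → x ∈ p → x ∈ q
  lookup≡∧∈⇒∈ {x = x} {q = q} eq x∈p = lookup⇒[]= x q (trans (sym eq) ([]=⇒lookup x∈p))

  ∈⇔∈⇒lookup≡ : (x ∈ p → x ∈ q) → (x ∈ q → x ∈ p) → lookup p x ≡ lookup q x
  ∈⇔∈⇒lookup≡ {x = x} p→q q→p = ⇔→≡ (mk⇔ (transport p→q) (transport q→p))
    where
    transport : (x ∈ r → x ∈ q) → lookup r x ≡ true → lookup q x ≡ true
    transport {r = r} r→q eq = []=⇒lookup (r→q (lookup⇒[]= x r eq))

  AgreeOn : Subset n → Subset n → Subset n → Set
  AgreeOn S a b = ∀ {e} → e ∈ S → lookup a e ≡ lookup b e

  DifferOn : Subset n → Subset n → Subset n → Set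
  DifferOn S a b = ∃ λ e → e ∈ S × lookup a e ≢ lookup b e

  agree-or-differ : ∀ (S a b : Subset n) → AgreeOn S a b ⊎ DifferOn S a b
  agree-or-differ S a b with any? (λ e → (e ∈? S) ×-dec ¬? (lookup a e Bool.≟ lookup b e))
  ... | yes differ = inj₂ differ
  ... | no ¬differ = inj₁ λ {e} e∈S →
    decidable-stable (lookup a e Bool.≟ lookup b e) (λ a≢b → ¬differ (e , e∈S , a≢b))

  agree⇒∩≡ : ∀ {S a b : Subset n} → AgreeOn S a b → S ∩ a ≡ S ∩ b
  agree⇒∩≡ {S = []}        {[]}    {[]}    _     = refl
  agree⇒∩≡ {S = true  ∷ S} {_ ∷ _} {_ ∷ _} agree = cong₂ _∷_ (agree here) (agree⇒∩≡ (agree ∘ there))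
  agree⇒∩≡ {S = false ∷ S} {_ ∷ _} {_ ∷ _} agree = cong (false ∷_) (agree⇒∩≡ (agree ∘ there))

  AtMostOneOutside : Subset n → Subset n → Set
  AtMostOneOutside p q = ∀ {x y} → x ∈ q → y ∈ q → x ∉ p → y ∉ p → x ≡ y

  ∣q∣∸1≤∣p∩q∣⇔AtMostOneOutside : ∣ q ∣ ∸ 1 ≤ ∣ p ∩ q ∣ ⇔ AtMostOneOutside p q
  ∣q∣∸1≤∣p∩q∣⇔AtMostOneOutside {q = q} {p = p} = mk⇔ at-most-one bound
    where
    at-most-one : ∣ q ∣ ∸ 1 ≤ ∣ p ∩ q ∣ → AtMostOneOutside p q
    at-most-one large {x} {y} x∈q y∈q x∉p y∉p with x ≟ y
    ... | yes x≡y = x≡y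
    ... | no x≢y  = ⊥-elim (<-irrefl refl (begin-strict
      ∣ p ∩ q ∣       ≤⟨ p⊆q⇒∣p∣≤∣q∣ p∩q⊆q-x-y ⟩
      ∣ (q - x) - y ∣ <⟨ x∈p⇒∣p-x∣<∣p∣ (x∈p∧x≢y⇒x∈p-y y∈q (x≢y ∘ sym)) ⟩
      ∣ q - x ∣       ≤⟨ ∸-monoˡ-≤ 1 (x∈p⇒∣p-x∣<∣p∣ x∈q) ⟩
      ∣ q ∣ ∸ 1       ≤⟨ large ⟩
      ∣ p ∩ q ∣       ∎))
      where
      open ≤-Reasoning
      p∩q⊆q-x-y : p ∩ q ⊆ (q - x) - y
      p∩q⊆q-x-y z∈p∩q with x∈p∩q⁻ p q z∈p∩q
      ... | z∈p , z∈q = x∈p∧x≢y⇒x∈p-y (x∈p∧x≢y⇒x∈p-y z∈q λ { refl → x∉p z∈p }) λ { refl → y∉p z∈p }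
    bound : AtMostOneOutside p q → ∣ q ∣ ∸ 1 ≤ ∣ p ∩ q ∣
    bound one with any? (λ x → (x ∈? q) ×-dec ¬? (x ∈? p))
    ... | no none = ≤-trans (m∸n≤m _ 1) (p⊆q⇒∣p∣≤∣q∣ λ {x} x∈q →
      x∈p∩q⁺ (decidable-stable (x ∈? p) (λ x∉p → none (x , x∈q , x∉p)) , x∈q))
    ... | yes (x , x∈q , x∉p) = ≤-trans (∸-monoˡ-≤ 1 (∣p∣≤1+∣p-x∣ q x)) (p⊆q⇒∣p∣≤∣q∣ q-x⊆p∩q)
      where
      q-x⊆p∩q : q - x ⊆ p ∩ q
      q-x⊆p∩q {y} y∈q-x = x∈p∩q⁺ (y∈p , y∈q)
        where
        y∈q : y ∈ q
        y∈q = p─q⊆p q ⁅ x ⁆ y∈q-x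
        y∈p : y ∈ p
        y∈p = decidable-stable (y ∈? p) (λ y∉p → x∈p-y⇒x≢y y∈q-x (one y∈q x∈q y∉p x∉p))

open SubsetProperties

module MatroidProperties {n : ℕ} (M : Matroid n) where
  open Matroid M
  open import Data.Nat using (suc; _≤_; _<_; s≤s)
  open import Data.Nat.Properties using (≤-<-trans; ≮⇒≥; <-irrefl; module ≤-Reasoning)

  bases-⊆⇒≡ : ∀ {A B} → IsBasis M A → IsBasis M B → A ⊆ B → A ≡ B
  bases-⊆⇒≡ (_ , maximal) (indepB , _) A⊆B = sym (maximal _ indepB A⊆B)

  basis-maximal : ∀ {B e} → IsBasis M B → e ∉ B → ¬ Indep (B ∪ ⁅ e ⁆)
  basis-maximal {B} {e} (_ , maximal) e∉B indep =
    e∉B (subst (e ∈_) (maximal _ indep (p⊆p∪q ⁅ e ⁆)) x∈p∪⁅x⁆)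

  maximal⇒basis : ∀ {B} → Indep B → (∀ {e} → e ∉ B → ¬ Indep (B ∪ ⁅ e ⁆)) → IsBasis M B
  maximal⇒basis {B} indepB maximal = indepB , λ A indepA B⊆A → ⊆-antisym (A⊆B indepA B⊆A) B⊆A
    where
    A⊆B : ∀ {A} → Indep A → B ⊆ A → A ⊆ B
    A⊆B {A} indepA B⊆A = decidable-stable (A ⊆? B) λ A⊈B →
      let x , x∈A , x∉B = p⊈q⇒∃x∈p∉q A⊈B
      in maximal x∉B (indep-⊆ A _ (p⊆r∧x∈r⇒p∪⁅x⁆⊆r B⊆A x∈A) indepA)

  isBasis? : Decidable (IsBasis M)
  isBasis? B = indep? B ×-dec map′ no-larger⇒maximal maximal⇒no-larger (¬? (anySubset? larger?))
    where
    Maximal : Set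
    Maximal = ∀ A → Indep A → B ⊆ A → A ≡ B
    Larger : Subset n → Set
    Larger A = Indep A × B ⊆ A × A ≢ B
    larger? : Decidable Larger
    larger? A = indep? A ×-dec (B ⊆? A ×-dec ¬? (A ≟ₛ B))
    no-larger⇒maximal : ¬ ∃ Larger → Maximal
    no-larger⇒maximal none A indepA B⊆A =
      decidable-stable (A ≟ₛ B) λ A≢B → none (A , indepA , B⊆A , A≢B)
    maximal⇒no-larger : Maximal → ¬ ∃ Larger
    maximal⇒no-larger maximal (A , indepA , B⊆A , A≢B) = A≢B (maximal A indepA B⊆A)

  record MaximalExtension (U I : Subset n) : Set where
    field
      set         : Subset n
      independent : Indep set
      ⊇I          : I ⊆ set
      ⊆I∪U        : set ⊆ I ∪ U
      maximal     : ∀ {e} → e ∈ U → e ∉ set → ¬ Indep (set ∪ ⁅ e ⁆)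

  saturate : ∀ U {I} → Indep I → Acc _⊃_ I → MaximalExtension U I
  saturate U {I} indepI (acc rs) with any? (λ e → (e ∈? U) ×-dec (¬? (e ∈? I) ×-dec indep? (I ∪ ⁅ e ⁆)))
  ... | no stuck = record
    { set         = I
    ; independent = indepI
    ; ⊇I          = ⊆-refl
    ; ⊆I∪U        = p⊆p∪q U
    ; maximal     = λ e∈U e∉I indep → stuck (_ , e∈U , e∉I , indep)
    }
  ... | yes (e , e∈U , e∉I , indepI+e) = record
    { MaximalExtension larger
    ; ⊇I   = ⊆-trans (p⊆p∪q ⁅ e ⁆) ⊇I
    ; ⊆I∪U = ⊆-trans ⊆I∪U absorb
    }
    where
    larger : MaximalExtension U (I ∪ ⁅ e ⁆)
    larger = saturate U indepI+e (rs (x∉p⇒p⊂p∪⁅x⁆ e∉I))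
    open MaximalExtension larger
    absorb : (I ∪ ⁅ e ⁆) ∪ U ⊆ I ∪ U
    absorb x∈I+e∪U with x∈p∪q⁻ (I ∪ ⁅ e ⁆) U x∈I+e∪U
    ... | inj₂ x∈U = x∈p∪q⁺ (inj₂ x∈U)
    ... | inj₁ x∈I+e with x∈p∪⁅y⁆⁻ x∈I+e
    ...   | inj₁ x∈I = x∈p∪q⁺ (inj₁ x∈I)
    ...   | inj₂ refl = x∈p∪q⁺ (inj₂ e∈U)

  extend-to-basis : ∀ {I} → Indep I → ∃ λ B → IsBasis M B × I ⊆ B
  extend-to-basis indepI = set , maximal⇒basis independent (maximal ∈⊤) , ⊇I
    where open MaximalExtension (saturate ⊤ indepI (⊃-wellFounded _))

  augment : ∀ {I J} → Indep I → Indep J → ∃ λ K → Indep K × I ⊆ K × K ⊆ I ∪ J × ∣ J ∣ ≤ ∣ K ∣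
  augment {I} {J} indepI indepJ = set , independent , ⊇I , ⊆I∪U , ≮⇒≥ not-smaller
    where
    open MaximalExtension (saturate J indepI (⊃-wellFounded _))
    not-smaller : ¬ ∣ set ∣ < ∣ J ∣
    not-smaller smaller =
      let e , e∈J , e∉K , indep = indep-aug set J independent indepJ smaller
      in maximal e∈J e∉K indep

  large-indep⇒basis : ∀ {B J} → IsBasis M B → Indep J → ∣ B ∣ ≤ ∣ J ∣ → IsBasis M J
  large-indep⇒basis {B} {J} basisB indepJ B≤J = maximal⇒basis indepJ λ {g} g∉J indep →
    let h , _ , h∉B , indepB+h = indep-aug B (J ∪ ⁅ g ⁆) (proj₁ basisB) indep
                                   (≤-<-trans B≤J (p⊂q⇒∣p∣<∣q∣ (x∉p⇒p⊂p∪⁅x⁆ g∉J)))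
    in basis-maximal basisB h∉B indepB+h

  circuit-deletion : ∀ {C x} → IsCircuit M C → x ∈ C → Indep (C - x)
  circuit-deletion {C} {x} (_ , minimal) x∈C =
    minimal (C - x) (p─q⊆p C ⁅ x ⁆) λ C-x≡C → x∉p-x C x (subst (x ∈_) (sym C-x≡C) x∈C)

  deletion-minimal⇒circuit : ∀ {D} → ¬ Indep D → (∀ {x} → x ∈ D → Indep (D - x)) → IsCircuit M D
  deletion-minimal⇒circuit {D} dependent deletion = dependent , λ D′ D′⊆D D′≢D →
    let x , x∈D , x∉D′ = p⊈q⇒∃x∈p∉q (D′≢D ∘ ⊆-antisym D′⊆D)
    in indep-⊆ (D - x) D′ (λ y∈D′ → x∈p∧x≢y⇒x∈p-y (D′⊆D y∈D′) λ { refl → x∉D′ y∈D′ }) (deletion x∈D)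

  dependent⇒circuit : ∀ {D} → ¬ Indep D → ∃ λ C → IsCircuit M C × C ⊆ D
  dependent⇒circuit dependent = shrink dependent (⊂-wellFounded _)
    where
    shrink : ∀ {D} → ¬ Indep D → Acc _⊂_ D → ∃ λ C → IsCircuit M C × C ⊆ D
    shrink {D} dependent (acc rs) with any? (λ x → (x ∈? D) ×-dec ¬? (indep? (D - x)))
    ... | yes (x , x∈D , dependent′) =
      let C , circuit , C⊆D-x = shrink dependent′ (rs (x∈p⇒p-x⊂p x∈D))
      in C , circuit , ⊆-trans C⊆D-x (p─q⊆p D ⁅ x ⁆)
    ... | no none = D , deletion-minimal⇒circuit dependent deletion , ⊆-refl
      where
      deletion : ∀ {x} → x ∈ D → Indep (D - x)
      deletion x∈D = decidable-stable (indep? _) λ dependent′ → none (_ , x∈D , dependent′)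

  fundamental-circuit : ∀ {B e} → IsBasis M B → e ∉ B → ∃ λ C → IsCircuit M C × e ∈ C × C - e ⊆ B
  fundamental-circuit {B} {e} basisB e∉B with dependent⇒circuit (basis-maximal basisB e∉B)
  ... | C , circuit , C⊆B+e = C , circuit , e∈C , C-e⊆B
    where
    C-e⊆B : C - e ⊆ B
    C-e⊆B g∈C-e with x∈p∪⁅y⁆⁻ (C⊆B+e (p─q⊆p C ⁅ e ⁆ g∈C-e))
    ... | inj₁ g∈B = g∈B
    ... | inj₂ refl = contradiction g∈C-e (x∉p-x C e)
    e∈C : e ∈ C
    e∈C = decidable-stable (e ∈? C) λ e∉C →
      proj₁ circuit (indep-⊆ B C (λ g∈C → C-e⊆B (x∈p∧x≢y⇒x∈p-y g∈C λ { refl → e∉C g∈C })) (proj₁ basisB))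

  -- Opaque because matching on the result would otherwise unfold the whole greedy construction.
  opaque
    circuit-exchange : ∀ {C e f} → IsCircuit M C → e ∈ C → f ∈ C → e ≢ f →
      ∃₂ λ B₁ B₂ → IsBasis M B₁ × IsBasis M B₂ × e ∉ B₁ × e ∈ B₂ × B₁ - f ⊆ B₂ × B₂ - e ⊆ B₁
    circuit-exchange {C} {e} {f} circuit e∈C f∈C e≢f
      with extend-to-basis (circuit-deletion circuit e∈C)
    ... | B₁ , basisB₁ , C-e⊆B₁
      with augment (circuit-deletion circuit f∈C) (proj₁ basisB₁)
    ... | B₂ , indepB₂ , C-f⊆B₂ , B₂⊆C-f∪B₁ , B₁≤B₂ =
      B₁ , B₂ , basisB₁ , large-indep⇒basis basisB₁ indepB₂ B₁≤B₂ ,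
      e∉B₁ , C-f⊆B₂ (x∈p∧x≢y⇒x∈p-y e∈C e≢f) , B₁-f⊆B₂ , B₂-e⊆B₁
      where
      ∉-by-dependence : ∀ {B x} → Indep B → C - x ⊆ B → x ∉ B
      ∉-by-dependence indepB C-x⊆B x∈B =
        proj₁ circuit (indep-⊆ _ C (p-x⊆r∧x∈r⇒p⊆r C-x⊆B x∈B) indepB)
      e∉B₁ : e ∉ B₁
      e∉B₁ = ∉-by-dependence (proj₁ basisB₁) C-e⊆B₁
      f∉B₂ : f ∉ B₂
      f∉B₂ = ∉-by-dependence indepB₂ C-f⊆B₂
      f∈B₁ : f ∈ B₁
      f∈B₁ = C-e⊆B₁ (x∈p∧x≢y⇒x∈p-y f∈C (e≢f ∘ sym))
      B₂-e⊆B₁ : B₂ - e ⊆ B₁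
      B₂-e⊆B₁ g∈B₂-e with x∈p∪q⁻ (C - f) B₁ (B₂⊆C-f∪B₁ (p─q⊆p B₂ ⁅ e ⁆ g∈B₂-e))
      ... | inj₁ g∈C-f = C-e⊆B₁ (x∈p∧x≢y⇒x∈p-y (p─q⊆p C ⁅ f ⁆ g∈C-f) (x∈p-y⇒x≢y g∈B₂-e))
      ... | inj₂ g∈B₁ = g∈B₁
      B₁-f⊆B₂ : B₁ - f ⊆ B₂
      B₁-f⊆B₂ {g} g∈B₁-f = decidable-stable (g ∈? B₂) λ g∉B₂ → <-irrefl refl (begin-strict
        ∣ B₁ ∣                ≤⟨ B₁≤B₂ ⟩
        ∣ B₂ ∣                ≤⟨ ∣p∣≤1+∣p-x∣ B₂ e ⟩
        suc ∣ B₂ - e ∣        ≤⟨ s≤s (p⊆q⇒∣p∣≤∣q∣ (B₂-e⊆B₁-f-g g∉B₂)) ⟩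
        suc ∣ (B₁ - f) - g ∣  ≤⟨ x∈p⇒∣p-x∣<∣p∣ g∈B₁-f ⟩
        ∣ B₁ - f ∣            <⟨ x∈p⇒∣p-x∣<∣p∣ f∈B₁ ⟩
        ∣ B₁ ∣                ∎)
        where
        open ≤-Reasoning
        B₂-e⊆B₁-f-g : g ∉ B₂ → B₂ - e ⊆ (B₁ - f) - g
        B₂-e⊆B₁-f-g g∉B₂ {h} h∈B₂-e = x∈p∧x≢y⇒x∈p-y
          (x∈p∧x≢y⇒x∈p-y (B₂-e⊆B₁ h∈B₂-e) λ { refl → f∉B₂ h∈B₂ })
          λ { refl → g∉B₂ h∈B₂ }
          where
          h∈B₂ : h ∈ B₂
          h∈B₂ = p─q⊆p B₂ ⁅ e ⁆ h∈B₂-e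

  identifying⇒atMostOneOutside : ∀ {S C} → Identifying M S → IsCircuit M C → AtMostOneOutside S C
  identifying⇒atMostOneOutside {S} identifying circuit {e} {f} e∈C f∈C e∉S f∉S with e ≟ f
  ... | yes e≡f = e≡f
  ... | no e≢f with circuit-exchange circuit e∈C f∈C e≢f
  ...   | B₁ , B₂ , basisB₁ , basisB₂ , e∉B₁ , e∈B₂ , B₁-f⊆B₂ , B₂-e⊆B₁
    with identifying (B₁ , basisB₁) (B₂ , basisB₂) (λ B₁≡B₂ → e∉B₁ (subst (e ∈_) (sym B₁≡B₂) e∈B₂))
  ...   | g , g∈S , differ = ⊥-elim (differ (∈⇔∈⇒lookup≡
          (λ g∈B₁ → B₁-f⊆B₂ (x∈p∧x≢y⇒x∈p-y g∈B₁ λ { refl → f∉S g∈S }))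
          (λ g∈B₂ → B₂-e⊆B₁ (x∈p∧x≢y⇒x∈p-y g∈B₂ λ { refl → e∉S g∈S }))))

  atMostOneOutside⇒identifying : ∀ {S} → (∀ {C} → IsCircuit M C → AtMostOneOutside S C) → Identifying M S
  atMostOneOutside⇒identifying {S} one (x , basisX) (x′ , basisX′) x≢x′ with agree-or-differ S x x′
  ... | inj₂ differ = differ
  ... | inj₁ agree with p⊈q⇒∃x∈p∉q (x≢x′ ∘ sym ∘ bases-⊆⇒≡ basisX′ basisX)
  ...   | e , e∈x′ , e∉x with fundamental-circuit basisX e∉x
  ...     | C , circuit , e∈C , C-e⊆x = ⊥-elim (proj₁ circuit (indep-⊆ x′ C C⊆x′ (proj₁ basisX′)))
    where
    e∉S : e ∉ S
    e∉S e∈S = e∉x (lookup≡∧∈⇒∈ (sym (agree e∈S)) e∈x′)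
    C-e⊆x′ : C - e ⊆ x′
    C-e⊆x′ {g} g∈C-e = lookup≡∧∈⇒∈ (agree g∈S) (C-e⊆x g∈C-e)
      where
      g∈S : g ∈ S
      g∈S = decidable-stable (g ∈? S) λ g∉S →
        x∈p-y⇒x≢y g∈C-e (one circuit (p─q⊆p C ⁅ e ⁆ g∈C-e) e∈C g∉S e∉S)
    C⊆x′ : C ⊆ x′
    C⊆x′ = p-x⊆r∧x∈r⇒p⊆r C-e⊆x′ e∈x′

module OrderedFieldProperties (R : Reals) where
  open Reals R hiding (+-mono-≤)

  commutativeRing : CommutativeRing 0ℓ 0ℓ
  commutativeRing = record { isCommutativeRing = isCommutativeRing }

  open CommutativeRing commutativeRing using (ring; +-group; +-commutativeSemigroup)
  open CommutativeRing commutativeRing public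
    using (+-comm; +-assoc; +-identityˡ; -‿inverseˡ; -‿inverseʳ) renaming (sym to ≈-sym)
  open GroupProperties +-group public using (//-rightDividesˡ; //-rightDividesʳ)
  open RingProperties ring using (-1*x≈-x; -‿involutive)
  open CommutativeSemigroupProperties +-commutativeSemigroup public using (xy∙z≈xz∙y; xy∙z≈x∙zy)
  open IsTotalOrder isTotalOrder using (total; antisym)

  poset : Poset 0ℓ 0ℓ 0ℓ
  poset = record { isPartialOrder = IsTotalOrder.isPartialOrder isTotalOrder }

  open Poset poset public using () renaming (refl to ≤-refl; trans to ≤-trans; reflexive to ≤-reflexive)
  open import Relation.Binary.Reasoning.PartialOrder poset public

  +-monoˡ-≤ : ∀ z {x y} → x ≤ y → x + z ≤ y + z
  +-monoˡ-≤ z x≤y = Reals.+-mono-≤ R z x≤y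

  +-monoʳ-≤ : ∀ z {x y} → x ≤ y → z + x ≤ z + y
  +-monoʳ-≤ z {x} {y} x≤y = begin
    z + x ≈⟨ +-comm z x ⟩
    x + z ≤⟨ +-monoˡ-≤ z x≤y ⟩
    y + z ≈⟨ +-comm y z ⟩
    z + y ∎

  +-mono-≤ : ∀ {x y u v} → x ≤ y → u ≤ v → x + u ≤ y + v
  +-mono-≤ {y = y} {u} x≤y u≤v = ≤-trans (+-monoˡ-≤ u x≤y) (+-monoʳ-≤ y u≤v)

  +-cancelʳ-≤ : ∀ z {x y} → x + z ≤ y + z → x ≤ y
  +-cancelʳ-≤ z {x} {y} x+z≤y+z = begin
    x              ≈⟨ ≈-sym (//-rightDividesʳ z x) ⟩
    x + z + - z    ≤⟨ +-monoˡ-≤ (- z) x+z≤y+z ⟩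
    y + z + - z    ≈⟨ //-rightDividesʳ z y ⟩
    y              ∎

  x≤y⇒0≤y-x : ∀ {x y} → x ≤ y → 0# ≤ y + - x
  x≤y⇒0≤y-x {x} {y} x≤y = begin
    0#      ≈⟨ ≈-sym (-‿inverseʳ x) ⟩
    x + - x ≤⟨ +-monoˡ-≤ (- x) x≤y ⟩
    y + - x ∎

  0≤x⇒-x≤0 : ∀ {x} → 0# ≤ x → - x ≤ 0#
  0≤x⇒-x≤0 {x} 0≤x = begin
    - x      ≈⟨ ≈-sym (+-identityˡ (- x)) ⟩
    0# + - x ≤⟨ +-monoˡ-≤ (- x) 0≤x ⟩
    x + - x  ≈⟨ -‿inverseʳ x ⟩
    0#       ∎

  0≤1 : 0# ≤ 1#
  0≤1 with total 0# 1#
  ... | inj₁ 0≤1 = 0≤1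
  ... | inj₂ 1≤0 = begin
    0#          ≤⟨ *-nonneg 0≤-1 0≤-1 ⟩
    - 1# * - 1# ≈⟨ -1*x≈-x (- 1#) ⟩
    - - 1#      ≈⟨ -‿involutive 1# ⟩
    1#          ∎
    where
    0≤-1 : 0# ≤ - 1#
    0≤-1 = begin
      0#        ≤⟨ x≤y⇒0≤y-x 1≤0 ⟩
      0# + - 1# ≈⟨ +-identityˡ (- 1#) ⟩
      - 1#      ∎

  1≰0 : ¬ 1# ≤ 0#
  1≰0 1≤0 = 0≉1 (antisym 0≤1 1≤0)

  lower-bound : ∀ {m} (f : Subset m → Carrier) → ∃ λ L → ∀ A → L ≤ f A
  lower-bound {ℕ.zero} f = f [] , λ { [] → ≤-refl }
  lower-bound {ℕ.suc m} f with lower-bound (f ∘ (true ∷_)) | lower-bound (f ∘ (false ∷_))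
  ... | L₁ , L₁≤ | L₂ , L₂≤ with total L₁ L₂
  ...   | inj₁ L₁≤L₂ = L₁ , λ { (true ∷ A) → L₁≤ A ; (false ∷ A) → ≤-trans L₁≤L₂ (L₂≤ A) }
  ...   | inj₂ L₂≤L₁ = L₂ , λ { (true ∷ A) → ≤-trans L₂≤L₁ (L₁≤ A) ; (false ∷ A) → L₂≤ A }

module Weights (R : Reals) where
  open Reals R hiding (+-mono-≤)
  open OrderedFieldProperties R

  contribution : ∀ {n} → (Fin n → Carrier) → Subset n → Fin n → Carrier
  contribution γ A i = if lookup A i then γ i else 0#

  weight-mono : ∀ {n} (γ : Fin n → Carrier) {A B : Subset n} →
                (∀ i → contribution γ A i ≤ contribution γ B i) → weight R γ A ≤ weight R γ B
  weight-mono {ℕ.zero}  γ {[]}    {[]}    _  = ≤-refl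
  weight-mono {ℕ.suc n} γ {_ ∷ _} {_ ∷ _} ≤B = +-mono-≤ (≤B zero) (weight-mono (γ ∘ suc) (≤B ∘ suc))

  weight-gap : ∀ {n} (γ : Fin n → Carrier) {A B : Subset n} {K} →
               (∀ i → contribution γ A i ≤ contribution γ B i) →
               ∀ e → contribution γ A e + K ≤ contribution γ B e → weight R γ A + K ≤ weight R γ B
  weight-gap γ {a ∷ A} {b ∷ B} {K} ≤B zero gap = begin
    contribution γ (a ∷ A) zero + weight R (γ ∘ suc) A + K
      ≈⟨ xy∙z≈xz∙y _ _ K ⟩
    contribution γ (a ∷ A) zero + K + weight R (γ ∘ suc) A
      ≤⟨ +-mono-≤ gap (weight-mono (γ ∘ suc) (≤B ∘ suc)) ⟩
    weight R γ (b ∷ B) ∎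
  weight-gap γ {a ∷ A} {b ∷ B} {K} ≤B (suc e) gap = begin
    contribution γ (a ∷ A) zero + weight R (γ ∘ suc) A + K
      ≈⟨ +-assoc _ _ K ⟩
    contribution γ (a ∷ A) zero + (weight R (γ ∘ suc) A + K)
      ≤⟨ +-mono-≤ (≤B zero) (weight-gap (γ ∘ suc) (≤B ∘ suc) e gap) ⟩
    weight R γ (b ∷ B) ∎

  penalty : ∀ {n} → Subset n → Carrier → Fin n → Carrier
  penalty x K i = if lookup x i then - K else K

  module _ {K : Carrier} (0≤K : 0# ≤ K) {n} (S x* : Subset n) where

    penalty-mono : ∀ x i →
                   contribution (penalty x* K) (S ∩ x*) i ≤ contribution (penalty x* K) (S ∩ x) i
    penalty-mono x i rewrite lookup-zipWith _∧_ i S x* | lookup-zipWith _∧_ i S x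
      with lookup S i | lookup x* i | lookup x i
    ... | false | _     | _     = ≤-refl
    ... | true  | true  | true  = ≤-refl
    ... | true  | true  | false = 0≤x⇒-x≤0 0≤K
    ... | true  | false | true  = 0≤K
    ... | true  | false | false = ≤-refl

    penalty-gap : ∀ x {e} → e ∈ S → lookup x* e ≢ lookup x e →
                  contribution (penalty x* K) (S ∩ x*) e + K ≤ contribution (penalty x* K) (S ∩ x) e
    penalty-gap x {e} e∈S x*≢x
      rewrite lookup-zipWith _∧_ e S x* | lookup-zipWith _∧_ e S x | []=⇒lookup e∈S
      with lookup x* e | lookup x e
    ... | true  | true  = ⊥-elim (x*≢x refl)
    ... | true  | false = ≤-reflexive (-‿inverseˡ K)
    ... | false | true  = ≤-reflexive (+-identityˡ K)
    ... | false | false = ⊥-elim (x*≢x refl)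

    penalty-separates : ∀ x → DifferOn S x* x →
                        weight R (penalty x* K) (S ∩ x*) + K ≤ weight R (penalty x* K) (S ∩ x)
    penalty-separates x (e , e∈S , x*≢x) = weight-gap _ (penalty-mono x) e (penalty-gap x e∈S x*≢x)

module Controllability (R : Reals) {n : ℕ} (M : Matroid n) where
  open Reals R hiding (+-mono-≤)
  open OrderedFieldProperties R
  open Weights R
  open MatroidProperties M

  bounded-below : (c : Bases M → Carrier) → NonDecreasing R M c → ∃ λ L → ∀ x → L ≤ c x
  bounded-below c nonDecreasing = L , λ (A , basisA) → ≤-trans (L≤f A) (f≤c A basisA)
    where
    f : Subset n → Carrier
    f A with isBasis? A
    ... | yes basisA = c (A , basisA)
    ... | no _       = 0#
    -- c may depend on the proof of IsBasis; monotonicity along A ⊆ A compares two such proofs.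
    f≤c : ∀ A basisA → f A ≤ c (A , basisA)
    f≤c A basisA with isBasis? A
    ... | yes basisA′ = nonDecreasing (A , basisA′) (A , basisA) ⊆-refl
    ... | no ¬basisA  = contradiction basisA ¬basisA
    L : Carrier
    L = proj₁ (lower-bound f)
    L≤f : ∀ A → L ≤ f A
    L≤f = proj₂ (lower-bound f)

  indicator : Subset n → Subset n → Carrier
  indicator x y = if does (y ≟ₛ x) then 1# else 0#

  indicator-self : ∀ x → indicator x x ≡ 1#
  indicator-self x = cong (λ b → if b then 1# else 0#) (dec-true (x ≟ₛ x) refl)

  indicator-other : ∀ {x y} → y ≢ x → indicator x y ≡ 0#
  indicator-other {x} {y} y≢x = cong (λ b → if b then 1# else 0#) (dec-false (y ≟ₛ x) y≢x)

  indicator-nonDecreasing : ∀ x → NonDecreasing R M (indicator x ∘ proj₁)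
  indicator-nonDecreasing x (y , basisY) (z , basisZ) y⊆z rewrite bases-⊆⇒≡ basisY basisZ y⊆z = ≤-refl

  controlling⇒identifying : ∀ {S} → Controlling R M S → Identifying M S
  controlling⇒identifying {S} controlling (x , basisX) (x′ , basisX′) x≢x′ with agree-or-differ S x x′
  ... | inj₂ differ = differ
  ... | inj₁ agree with controlling (indicator x ∘ proj₁) (indicator-nonDecreasing x) (x , basisX)
  ...   | γ , optimal = ⊥-elim (1≰0 (+-cancelʳ-≤ (weight R γ (S ∩ x)) (begin
    1# + weight R γ (S ∩ x)              ≡⟨ cong (_+ weight R γ (S ∩ x)) (sym (indicator-self x)) ⟩
    indicator x x + weight R γ (S ∩ x)   ≤⟨ optimal (x′ , basisX′) ⟩
    indicator x x′ + weight R γ (S ∩ x′) ≡⟨ cong₂ _+_ (indicator-other (x≢x′ ∘ sym))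
                                                     (cong (weight R γ) (sym (agree⇒∩≡ agree))) ⟩
    0# + weight R γ (S ∩ x)              ∎)))

  identifying⇒controlling : ∀ {S} → Identifying M S → Controlling R M S
  identifying⇒controlling {S} identifying c nonDecreasing (x* , basisX*) = penalty x* K , optimal
    where
    c* : Carrier
    c* = c (x* , basisX*)
    L : Carrier
    L = proj₁ (bounded-below c nonDecreasing)
    L≤c : ∀ y → L ≤ c y
    L≤c = proj₂ (bounded-below c nonDecreasing)
    K : Carrier
    K = c* + - L
    0≤K : 0# ≤ K
    0≤K = x≤y⇒0≤y-x (L≤c (x* , basisX*))
    w : Subset n → Carrier
    w x = weight R (penalty x* K) (S ∩ x)
    c*≤c+K : ∀ y → c* ≤ c y + K
    c*≤c+K y = begin
      c*        ≈⟨ ≈-sym (//-rightDividesˡ L c*) ⟩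
      K + L     ≤⟨ +-monoʳ-≤ K (L≤c y) ⟩
      K + c y   ≈⟨ +-comm K (c y) ⟩
      c y + K   ∎
    optimal : ∀ y → c* + w x* ≤ c y + w (proj₁ y)
    optimal y@(x , _) with x* ≟ₛ x
    ... | yes refl = +-mono-≤ (nonDecreasing _ _ ⊆-refl) ≤-refl
    ... | no x*≢x  = begin
      c* + w x*        ≤⟨ +-monoˡ-≤ (w x*) (c*≤c+K y) ⟩
      c y + K + w x*   ≈⟨ xy∙z≈x∙zy (c y) K (w x*) ⟩
      c y + (w x* + K) ≤⟨ +-monoʳ-≤ (c y) (penalty-separates 0≤K S x* x differ) ⟩
      c y + w x        ∎
      where
      differ : DifferOn S x* x
      differ = identifying (x* , basisX*) y x*≢x

theorem5p3 : (R : Reals) → ∀ {n : ℕ} (M : Matroid n) (S : Subset n) →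
    ((Controlling R M S ⇔ Identifying M S) × (Identifying M S ⇔ CircuitCondition M S))
theorem5p3 R M S =
  mk⇔ controlling⇒identifying identifying⇒controlling ,
  mk⇔ (λ identifying C circuit → Equivalence.from ∣q∣∸1≤∣p∩q∣⇔AtMostOneOutside
                                   (identifying⇒atMostOneOutside identifying circuit))
      (λ condition → atMostOneOutside⇒identifying λ circuit →
                       Equivalence.to ∣q∣∸1≤∣p∩q∣⇔AtMostOneOutside (condition _ circuit))
  where
  open Controllability R M
  open MatroidProperties M
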